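{- Every cycle $C_n$ ($n\ge 3$) admits a $3$-good $11$-coloring.
   Context: A $3$-good $k$-coloring of a graph $G$ is an assignment to each vertex of a $3$-element subset of $\{1,\dots,k\}$ such that any two adjacent vertices receive disjoint sets, and any two vertices at distance exactly two share exactly one color. -}

module Defs where

open import Data.Nat using (ℕ; suc; _+_)
open import Data.Nat.DivMod using (_%_)
open import Data.Fin using (Fin; toℕ)
open import Data.Fin.Subset using (Subset; ∣_∣; _∩_)
open import Data.Product using (_×_; ∃)
open import Data.Sum using (_⊎_)
open import Relation.Nullary using (¬_)
open import Relation.Binary.PropositionalEquality using (_≡_)

AdjRel : ℕ → Set₁
AdjRel n = Fin n → Fin n → Set

Dist2 : ∀ {n} → AdjRel n → Fin n → Fin n → Set
Dist2 Adj u v = ¬ (u ≡ v) × ¬ Adj u v × ∃ λ w → Adj u w × Adj w v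

-- A 3-good k-colouring: each vertex gets a 3-element subset of {1..k}
-- (colours modelled as Fin k); adjacent vertices get disjoint sets;
-- vertices at distance exactly two share exactly one colour.
record ThreeGoodColoring {n : ℕ} (Adj : AdjRel n) (k : ℕ) : Set where
  field
    col      : Fin n → Subset k
    size3    : ∀ v → ∣ col v ∣ ≡ 3
    adjDisj  : ∀ u v → Adj u v → ∣ col u ∩ col v ∣ ≡ 0
    dist2One : ∀ u v → Dist2 Adj u v → ∣ col u ∩ col v ∣ ≡ 1

CycleAdj : (m : ℕ) → AdjRel (3 + m)
CycleAdj m i j = (toℕ j ≡ suc (toℕ i) % (3 + m)) ⊎ (toℕ i ≡ suc (toℕ j) % (3 + m))

-- Colour the cycle C_n by reading a sequence of colour sets around it. A sequence in
-- which consecutive sets are disjoint and sets two apart meet in exactly one colour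
-- gives a 3-good colouring of C_n as soon as it wraps around, i.e. its terms n and
-- n + 1 repeat its terms 0 and 1. The period-4 sequence {0,1,2}, {3,4,5}, {0,6,7},
-- {3,8,9}, … wraps around for n ≡ 0 (mod 4); for the other residues a block of
-- length 5, 6 or 7 replaces the first period. The triangle has no pairs at distance
-- two, so any three disjoint sets colour it.
module Submission where

open import Defs
open import Agda.Builtin.FromNat using (Number; fromNat)
open import Data.Nat using (ℕ; zero; suc; _+_; _<_; _≤_; s≤s; NonZero)
open import Data.Nat.Properties using (+-assoc; +-comm; +-identityʳ; suc-injective; ≤-trans; n≤1+n; m≤n⇒m<n∨m≡n)
open import Data.Nat.Literals using () renaming (number to natNumber)
open import Data.Nat.DivMod using (_%_; %-distribˡ-+; m%n%n≡m%n; m%n<n; m<n⇒m%n≡m; n%n≡0; [m+n]%n≡m%n)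
open import Data.Fin using (Fin; toℕ)
open import Data.Fin.Literals using () renaming (number to finNumber)
open import Data.Fin.Patterns using (0F; 1F; 2F)
open import Data.Fin.Properties using (toℕ-injective; toℕ<n)
open import Data.Fin.Subset using (Subset; ∣_∣; _∩_; _∪_; ⁅_⁆)
open import Data.Fin.Subset.Properties using (∩-comm)
open import Data.List using (List; []; _∷_)
open import Data.Product using (_×_; _,_; proj₁; proj₂)
open import Data.Sum using (_⊎_; inj₁; inj₂)
open import Data.Unit using (⊤; tt)
open import Data.Empty using (⊥-elim)
open import Relation.Nullary using (¬_)
open import Relation.Binary.PropositionalEquality using (_≡_; refl; sym; trans; cong; cong₂; module ≡-Reasoning)

open ≡-Reasoning

instance
  ⊤-instance : ⊤
  ⊤-instance = tt

  ℕ-number : Number ℕ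
  ℕ-number = natNumber

  Fin-number : ∀ {k} → Number (Fin k)
  Fin-number {k} = finNumber k

shared : ∀ {k} → Subset k → Subset k → ℕ
shared p q = ∣ p ∩ q ∣

shared-comm : ∀ {k} (p q : Subset k) → shared p q ≡ shared q p
shared-comm p q = cong ∣_∣ (∩-comm p q)

GoodAt : ∀ {k} → (ℕ → Subset k) → ℕ → Set
GoodAt s x = ∣ s x ∣ ≡ 3 × shared (s x) (s (1 + x)) ≡ 0 × shared (s x) (s (2 + x)) ≡ 1

Good : ∀ {k} → (ℕ → Subset k) → Set
Good s = ∀ x → GoodAt s x

[m+n%d]%d≡[m+n]%d : ∀ m n d .{{_ : NonZero d}} → (m + n % d) % d ≡ (m + n) % d
[m+n%d]%d≡[m+n]%d m n d = begin
  (m + n % d) % d          ≡⟨ %-distribˡ-+ m (n % d) d ⟩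
  (m % d + n % d % d) % d  ≡⟨ cong (λ t → (m % d + t) % d) (m%n%n≡m%n n d) ⟩
  (m % d + n % d) % d      ≡⟨ %-distribˡ-+ m n d ⟨
  (m + n) % d              ∎

suc-%-cases : ∀ {a n} .{{_ : NonZero n}} → a < n → suc a % n ≡ suc a ⊎ (suc a % n ≡ 0 × suc a ≡ n)
suc-%-cases a<n with m≤n⇒m<n∨m≡n a<n
... | inj₁ 1+a<n = inj₁ (m<n⇒m%n≡m 1+a<n)
... | inj₂ refl  = inj₂ (n%n≡0 _ , refl)

suc-%-injective : ∀ {a b n} .{{_ : NonZero n}} → a < n → b < n → suc a % n ≡ suc b % n → a ≡ b
suc-%-injective a<n b<n eq with suc-%-cases a<n | suc-%-cases b<n
... | inj₁ ea       | inj₁ eb       = suc-injective (trans (sym ea) (trans eq eb))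
... | inj₁ ea       | inj₂ (eb , _) with () ← trans (sym ea) (trans eq eb)
... | inj₂ (ea , _) | inj₁ eb       with () ← trans (sym eb) (trans (sym eq) ea)
... | inj₂ (_ , fa) | inj₂ (_ , fb) = suc-injective (trans fa (sym fb))

-- Only the terms below n + 2 matter, so by the wrap-around equations s (x % n) is a
-- good sequence too, and in it adjacency on C_n is simply "x and 1 + x".
module _ {k : ℕ} (m : ℕ) (s : ℕ → Subset k) (good : Good s)
         (wrap₀ : s (3 + m) ≡ s 0) (wrap₁ : s (4 + m) ≡ s 1) where

  private
    n : ℕ
    n = 3 + m

    cyclic : ℕ → Subset k
    cyclic x = s (x % n)

    cyclic≡s : ∀ z → z ≤ 1 + n → cyclic z ≡ s z
    cyclic≡s z z≤1+n with m≤n⇒m<n∨m≡n z≤1+n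
    ... | inj₂ refl = trans (cong s ([m+n]%n≡m%n 1 n)) (sym wrap₁)
    ... | inj₁ (s≤s z≤n′) with m≤n⇒m<n∨m≡n z≤n′
    ...   | inj₁ z<n = cong s (m<n⇒m%n≡m z<n)
    ...   | inj₂ refl = trans (cong s (n%n≡0 n)) (sym wrap₀)

    cyclic-+-% : ∀ j x → cyclic (j + x % n) ≡ cyclic (j + x)
    cyclic-+-% j x = cong s ([m+n%d]%d≡[m+n]%d j x n)

    cyclic-good : Good cyclic
    cyclic-good x with good (x % n)
    ... | size , disjoint , meet =
      size , trans (cong (shared (cyclic x)) shift₁) disjoint , trans (cong (shared (cyclic x)) shift₂) meet
      where
      y<n : x % n < n
      y<n = m%n<n x n

      shift₁ : cyclic (1 + x) ≡ s (1 + x % n)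
      shift₁ = trans (sym (cyclic-+-% 1 x)) (cyclic≡s (1 + x % n) (≤-trans y<n (n≤1+n n)))

      shift₂ : cyclic (2 + x) ≡ s (2 + x % n)
      shift₂ = trans (sym (cyclic-+-% 2 x)) (cyclic≡s (2 + x % n) (s≤s y<n))

    toℕ-cyclic : ∀ (v : Fin n) → s (toℕ v) ≡ cyclic (toℕ v)
    toℕ-cyclic v = cong s (sym (m<n⇒m%n≡m {n = n} (toℕ<n v)))

    consecutive-disjoint : ∀ (u v : Fin n) → toℕ v ≡ suc (toℕ u) % n →
                           shared (s (toℕ u)) (s (toℕ v)) ≡ 0
    consecutive-disjoint u v e = begin
      shared (s (toℕ u)) (s (toℕ v))               ≡⟨ cong₂ shared (toℕ-cyclic u) (cong s e) ⟩
      shared (cyclic (toℕ u)) (cyclic (1 + toℕ u)) ≡⟨ proj₁ (proj₂ (cyclic-good (toℕ u))) ⟩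
      0                                            ∎

    two-apart-meet : ∀ (u w v : Fin n) → toℕ w ≡ suc (toℕ u) % n → toℕ v ≡ suc (toℕ w) % n →
                     shared (s (toℕ u)) (s (toℕ v)) ≡ 1
    two-apart-meet u w v e₁ e₂ = begin
      shared (s (toℕ u)) (s (toℕ v))
        ≡⟨ cong₂ shared (toℕ-cyclic u) (cong s e₂) ⟩
      shared (cyclic (toℕ u)) (cyclic (1 + toℕ w))
        ≡⟨ cong (λ t → shared (cyclic (toℕ u)) (cyclic (1 + t))) e₁ ⟩
      shared (cyclic (toℕ u)) (cyclic (1 + suc (toℕ u) % n))
        ≡⟨ cong (shared (cyclic (toℕ u))) (cyclic-+-% 1 (suc (toℕ u))) ⟩
      shared (cyclic (toℕ u)) (cyclic (2 + toℕ u))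
        ≡⟨ proj₂ (proj₂ (cyclic-good (toℕ u))) ⟩
      1 ∎

  Good⇒ThreeGoodColoring : ThreeGoodColoring (CycleAdj m) k
  Good⇒ThreeGoodColoring = record
    { col      = λ v → s (toℕ v)
    ; size3    = λ v → proj₁ (good (toℕ v))
    ; adjDisj  = adjacent
    ; dist2One = distanceTwo
    }
    where
    adjacent : ∀ (u v : Fin n) → CycleAdj m u v → shared (s (toℕ u)) (s (toℕ v)) ≡ 0
    adjacent u v (inj₁ e) = consecutive-disjoint u v e
    adjacent u v (inj₂ e) = trans (shared-comm (s (toℕ u)) (s (toℕ v))) (consecutive-disjoint v u e)

    distanceTwo : ∀ (u v : Fin n) → Dist2 (CycleAdj m) u v → shared (s (toℕ u)) (s (toℕ v)) ≡ 1
    distanceTwo u v (_ , _ , w , inj₁ e₁ , inj₁ e₂) = two-apart-meet u w v e₁ e₂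
    distanceTwo u v (_ , _ , w , inj₂ e₁ , inj₂ e₂) =
      trans (shared-comm (s (toℕ u)) (s (toℕ v))) (two-apart-meet v w u e₂ e₁)
    distanceTwo u v (u≢v , _ , w , inj₁ e₁ , inj₂ e₂) =
      ⊥-elim (u≢v (toℕ-injective (suc-%-injective {n = n} (toℕ<n u) (toℕ<n v) (trans (sym e₁) e₂))))
    distanceTwo u v (u≢v , _ , w , inj₂ e₁ , inj₁ e₂) = ⊥-elim (u≢v (toℕ-injective (trans e₁ (sym e₂))))

colours : ∀ {k} → Fin k → Fin k → Fin k → Subset k
colours i j l = ⁅ i ⁆ ∪ ⁅ j ⁆ ∪ ⁅ l ⁆

_▹_ : ∀ {A : Set} → List A → (ℕ → A) → ℕ → A
([]    ▹ s) x       = s x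
(a ∷ w ▹ s) zero    = a
(a ∷ w ▹ s) (suc x) = (w ▹ s) x

infixr 4 _▹_

period : ℕ → Subset 11
period 0 = colours 0 1 2
period 1 = colours 3 4 5
period 2 = colours 0 6 7
period 3 = colours 3 8 9
period (suc (suc (suc (suc x)))) = period x

period-good : Good period
period-good 0 = refl , refl , refl
period-good 1 = refl , refl , refl
period-good 2 = refl , refl , refl
period-good 3 = refl , refl , refl
period-good (suc (suc (suc (suc x)))) = period-good x

-- cycleColours m is read around C_(4 + m). Each block agrees with the period in its
-- first three sets, and the period resumes right after it.
cycleColours : ℕ → ℕ → Subset 11
cycleColours 0 = period
cycleColours 1 = period 0 ∷ period 1 ∷ period 2
               ∷ colours 1 3 8 ∷ colours 4 6 9 ∷ [] ▹ period
cycleColours 2 = period 0 ∷ period 1 ∷ period 2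
               ∷ colours 1 2 3 ∷ colours 0 4 5 ∷ colours 3 6 7 ∷ [] ▹ period
cycleColours 3 = period 0 ∷ period 1 ∷ period 2
               ∷ colours 1 2 3 ∷ colours 0 4 5 ∷ colours 1 6 7 ∷ colours 4 8 9 ∷ [] ▹ period
cycleColours (suc (suc (suc (suc m)))) = cycleColours m

cycleColours-good : ∀ m → Good (cycleColours m)
cycleColours-good 0 x = period-good x
cycleColours-good 1 0 = refl , refl , refl
cycleColours-good 1 1 = refl , refl , refl
cycleColours-good 1 2 = refl , refl , refl
cycleColours-good 1 3 = refl , refl , refl
cycleColours-good 1 4 = refl , refl , refl
cycleColours-good 1 (suc (suc (suc (suc (suc x))))) = period-good x
cycleColours-good 2 0 = refl , refl , refl
cycleColours-good 2 1 = refl , refl , refl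
cycleColours-good 2 2 = refl , refl , refl
cycleColours-good 2 3 = refl , refl , refl
cycleColours-good 2 4 = refl , refl , refl
cycleColours-good 2 5 = refl , refl , refl
cycleColours-good 2 (suc (suc (suc (suc (suc (suc x)))))) = period-good x
cycleColours-good 3 0 = refl , refl , refl
cycleColours-good 3 1 = refl , refl , refl
cycleColours-good 3 2 = refl , refl , refl
cycleColours-good 3 3 = refl , refl , refl
cycleColours-good 3 4 = refl , refl , refl
cycleColours-good 3 5 = refl , refl , refl
cycleColours-good 3 6 = refl , refl , refl
cycleColours-good 3 (suc (suc (suc (suc (suc (suc (suc x))))))) = period-good x
cycleColours-good (suc (suc (suc (suc m)))) x = cycleColours-good m x

cycleColours-head : ∀ m → cycleColours m 0 ≡ period 0 × cycleColours m 1 ≡ period 1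
cycleColours-head 0 = refl , refl
cycleColours-head 1 = refl , refl
cycleColours-head 2 = refl , refl
cycleColours-head 3 = refl , refl
cycleColours-head (suc (suc (suc (suc m)))) = cycleColours-head m

cycleColours-tail : ∀ m j → cycleColours m (4 + m + j) ≡ period j
cycleColours-tail 0 j = refl
cycleColours-tail 1 j = refl
cycleColours-tail 2 j = refl
cycleColours-tail 3 j = refl
cycleColours-tail (suc (suc (suc (suc m)))) j = begin
  cycleColours m (8 + m + j)       ≡⟨ cong (λ t → cycleColours m (4 + t)) (m+[4+n]≡4+m+n m j) ⟨
  cycleColours m (4 + m + (4 + j)) ≡⟨ cycleColours-tail m (4 + j) ⟩
  period j                         ∎
  where
  m+[4+n]≡4+m+n : ∀ m n → m + (4 + n) ≡ 4 + m + n
  m+[4+n]≡4+m+n m n = trans (sym (+-assoc m 4 n)) (cong (_+ n) (+-comm m 4))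

cycleColours-wraps : ∀ m → cycleColours m (4 + m) ≡ cycleColours m 0
                         × cycleColours m (5 + m) ≡ cycleColours m 1
cycleColours-wraps m = wraps 0 (+-identityʳ (4 + m)) (proj₁ (cycleColours-head m))
                     , wraps 1 (+-comm (4 + m) 1) (proj₂ (cycleColours-head m))
  where
  wraps : ∀ j {x} → 4 + m + j ≡ x → cycleColours m j ≡ period j → cycleColours m x ≡ cycleColours m j
  wraps j refl head = trans (cycleColours-tail m j) (sym head)

triangle : Fin 3 → Subset 11
triangle 0F = colours 0 1 2
triangle 1F = colours 3 4 5
triangle 2F = colours 6 7 8

triangle-hasNoDist2 : ∀ (u v : Fin 3) → ¬ Dist2 (CycleAdj 0) u v
triangle-hasNoDist2 0F 0F (u≢v , _) = u≢v refl
triangle-hasNoDist2 1F 1F (u≢v , _) = u≢v refl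
triangle-hasNoDist2 2F 2F (u≢v , _) = u≢v refl
triangle-hasNoDist2 0F 1F (_ , ¬adj , _) = ¬adj (inj₁ refl)
triangle-hasNoDist2 1F 2F (_ , ¬adj , _) = ¬adj (inj₁ refl)
triangle-hasNoDist2 2F 0F (_ , ¬adj , _) = ¬adj (inj₁ refl)
triangle-hasNoDist2 1F 0F (_ , ¬adj , _) = ¬adj (inj₂ refl)
triangle-hasNoDist2 2F 1F (_ , ¬adj , _) = ¬adj (inj₂ refl)
triangle-hasNoDist2 0F 2F (_ , ¬adj , _) = ¬adj (inj₂ refl)

triangleColoring : ThreeGoodColoring (CycleAdj 0) 11
triangleColoring = record
  { col      = triangle
  ; size3    = λ { 0F → refl ; 1F → refl ; 2F → refl }
  ; adjDisj  = disjoint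
  ; dist2One = λ u v d → ⊥-elim (triangle-hasNoDist2 u v d)
  }
  where
  disjoint : ∀ (u v : Fin 3) → CycleAdj 0 u v → shared (triangle u) (triangle v) ≡ 0
  disjoint 0F 0F (inj₁ ())
  disjoint 0F 0F (inj₂ ())
  disjoint 1F 1F (inj₁ ())
  disjoint 1F 1F (inj₂ ())
  disjoint 2F 2F (inj₁ ())
  disjoint 2F 2F (inj₂ ())
  disjoint 0F 1F _ = refl
  disjoint 0F 2F _ = refl
  disjoint 1F 0F _ = refl
  disjoint 1F 2F _ = refl
  disjoint 2F 0F _ = refl
  disjoint 2F 1F _ = refl

mainTheorem5 : (m : ℕ) → ThreeGoodColoring (CycleAdj m) 11
mainTheorem5 zero    = triangleColoring
mainTheorem5 (suc m) =
  Good⇒ThreeGoodColoring (suc m) (cycleColours m) (cycleColours-good m)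
    (proj₁ (cycleColours-wraps m)) (proj₂ (cycleColours-wraps m))
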